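{- Let $G$ be a polyhedron of graph radius $1$ that is not isomorphic to $T_\ell$ for any $\ell\geq 2$. Then $G$ has exactly one vertex of eccentricity $1$.
   Context: All graphs are finite, simple and undirected. A polyhedron is a planar $3$-connected graph. A vertex of eccentricity $1$ is one adjacent to all other vertices; graph radius $1$ means such a vertex exists. $T_\ell=P_\ell+K_2$ is the join of the path $P_\ell$ on $\ell$ vertices with $K_2$ (i.e., a path on $\ell$ vertices plus two adjacent vertices each adjacent to all path vertices). -}

module Defs where

open import Data.Nat using (ℕ; zero; suc; _+_; _*_; _≤_; _≡ᵇ_)
open import Data.Fin using (Fin; zero; suc; toℕ)
open import Data.Bool using (Bool; true; false; _∨_)
open import Data.Product using (Σ; ∃; _×_; _,_; proj₁; proj₂)
open import Data.List using (List; length)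
open import Data.List.Membership.Propositional using (_∉_)
open import Relation.Binary.PropositionalEquality using (_≡_)
open import Relation.Nullary using (¬_)

record Graph (n : ℕ) : Set where
  field
    E     : Fin n → Fin n → Bool
    sym   : ∀ u v → E u v ≡ E v u
    irrefl : ∀ v → E v v ≡ false

module _ {n : ℕ} (G : Graph n) where
  open Graph G

  Adj : Fin n → Fin n → Set
  Adj u v = E u v ≡ true

  data WalkIn (P : Fin n → Set) : Fin n → Fin n → Set where
    here : ∀ {u} → WalkIn P u u
    step : ∀ {u w v} → Adj u w → P w → WalkIn P w v → WalkIn P u v

  ThreeConnected : Set
  ThreeConnected =
    (4 ≤ n) ×
    (∀ (S : List (Fin n)) → length S ≤ 2 →
       ∀ u v → u ∉ S → v ∉ S → WalkIn (λ w → w ∉ S) u v)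

  Ecc1 : Fin n → Set
  Ecc1 v = ∀ w → ¬ (w ≡ v) → Adj v w

  Radius1 : Set
  Radius1 = ∃ λ v → Ecc1 v

  -- Planarity, combinatorially: a rotation system of Euler genus 0.
  -- Darts are indexed by Fin D; dart d goes from tail d to head d.
  iter : ∀ {D} → (Fin D → Fin D) → ℕ → Fin D → Fin D
  iter f zero    d = d
  iter f (suc k) d = f (iter f k d)

  record PlanarEmbedding : Set where
    field
      D      : ℕ
      tail   : Fin D → Fin n
      head   : Fin D → Fin n
      dartAdj : ∀ d → Adj (tail d) (head d)
      dartInj : ∀ d d' → tail d ≡ tail d' → head d ≡ head d' → d ≡ d'
      dartSurj : ∀ u v → Adj u v → Σ (Fin D) λ d → (tail d ≡ u) × (head d ≡ v)
      θ      : Fin D → Fin D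
      θ-tail : ∀ d → tail (θ d) ≡ head d
      θ-head : ∀ d → head (θ d) ≡ tail d
      σ      : Fin D → Fin D
      σ⁻¹    : Fin D → Fin D
      σσ⁻¹   : ∀ d → σ (σ⁻¹ d) ≡ d
      σ⁻¹σ   : ∀ d → σ⁻¹ (σ d) ≡ d
      σ-tail : ∀ d → tail (σ d) ≡ tail d
      σ-cyc  : ∀ d d' → tail d ≡ tail d' → ∃ λ k → iter σ k d ≡ d'
      -- faces = orbits of φ = σ ∘ θ, counted by a labelling face : Fin D → Fin f
      f      : ℕ
      face   : Fin D → Fin f
      face-φ : ∀ d → face (σ (θ d)) ≡ face d
      face-orbit : ∀ d d' → face d ≡ face d' → ∃ λ k → iter (λ x → σ (θ x)) k d ≡ d'
      face-surj  : ∀ (i : Fin f) → ∃ λ d → face d ≡ i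
      -- Euler's formula  n - m + f = 2  with D = 2m darts
      euler  : 2 * n + 2 * f ≡ D + 4

  Planar : Set
  Planar = PlanarEmbedding

  Polyhedron : Set
  Polyhedron = Planar × ThreeConnected

-- T_ℓ = P_ℓ + K₂ on Fin (2 + ℓ): vertices 0,1 form the K₂,
-- vertex 2+i is the i-th path vertex (i < ℓ).

pathE : ∀ {ℓ} → Fin ℓ → Fin ℓ → Bool
pathE i j = (suc (toℕ i) ≡ᵇ toℕ j) ∨ (suc (toℕ j) ≡ᵇ toℕ i)

TE : (ℓ : ℕ) → Fin (2 + ℓ) → Fin (2 + ℓ) → Bool
TE ℓ zero zero = false
TE ℓ zero (suc _) = true
TE ℓ (suc zero) zero = true
TE ℓ (suc zero) (suc zero) = false
TE ℓ (suc zero) (suc (suc _)) = true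
TE ℓ (suc (suc _)) zero = true
TE ℓ (suc (suc _)) (suc zero) = true
TE ℓ (suc (suc i)) (suc (suc j)) = pathE i j

record IsoToT {n : ℕ} (G : Graph n) (ℓ : ℕ) : Set where
  field
    to   : Fin n → Fin (2 + ℓ)
    from : Fin (2 + ℓ) → Fin n
    from-to : ∀ v → from (to v) ≡ v
    to-from : ∀ x → to (from x) ≡ x
    preserves : ∀ u v → Graph.E G u v ≡ TE ℓ (to u) (to v)

{-# OPTIONS --safe #-}

-- Suppose u ≢ v both have eccentricity 1, and let H = G − u − v; H is connected because G is
-- 3-connected. Faces have at least three darts, so
-- 3f ≤ D. The darts between {u, v} and H, the two darts of uv and the darts of a spanning tree of H
-- are distinct, so 6n − 12 ≤ D. Euler's formula 2n + 2f = D + 4 makes both bounds equalities: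
-- G is a triangulation, and every edge of H lies in any spanning tree of H. In a triangulation
-- consecutive darts of the rotation at u end in adjacent vertices, so reading the rotation from v
-- gives v, w₁, …, w_ℓ with w₁ … w_ℓ a Hamiltonian path of H. With this path as the spanning tree,
-- H has no further edges, and G ≅ T_ℓ.

module Submission where

open import Defs
open import Data.Bool as Bool using (Bool; true; if_then_else_; _∨_)
open import Data.Bool.Properties using (T-∨; T-≡; ⇔→≡)
open import Data.Empty using (⊥; ⊥-elim)
open import Data.Fin using (Fin; zero; suc; toℕ; fromℕ<; punchOut)
open import Data.Fin.Properties
  using (_≟_; any?; pigeonhole; injective⇒≤; punchOut-injective; toℕ-injective; toℕ<n; toℕ-fromℕ<;
         *↔×; +↔⊎)
open import Data.List using (List; []; _∷_; length; lookup)
open import Data.List.Membership.Propositional using (_∈_; _∉_)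
open import Data.List.Relation.Unary.Any using (here; there; index)
open import Data.List.Relation.Unary.Any.Properties using (lookup-index)
open import Data.Nat using (ℕ; zero; suc; pred; _+_; _*_; _≤_; _<_; _≡ᵇ_; s≤s; z≤n; z<s; s<s⁻¹; s≤s⁻¹)
open import Data.Nat.Properties
  using (≡ᵇ⇒≡; ≡⇒≡ᵇ; 1+n≰n; 1+n≢0; n<1+n; suc-injective; +-comm; ≤-trans; ≤-antisym; <-asym; <-cmp;
         ≮⇒≥; ≤∧≢⇒<; m≤n⇒m<n∨m≡n; m≤n⇒∃[o]m+o≡n; m+n≤o⇒m≤o; m≢1+n+m;
         +-cancelˡ-≡; +-cancelʳ-≤; +-monoʳ-≤; *-monoʳ-≤; *-cancelˡ-≡)
open import Data.Nat.Solver using (module +-*-Solver)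
open import Data.Product using (Σ; ∃; ∃₂; _×_; _,_; proj₁; proj₂)
open import Data.Product.Function.NonDependent.Propositional using (_×-↔_)
open import Data.Sum as Sum using (_⊎_; inj₁; inj₂; map₁; [_,_])
open import Data.Sum.Function.Propositional using (_⊎-↔_)
open import Data.Sum.Properties using (inj₁-injective)
open import Data.Unit using (⊤; tt)
open import Function using (_∘_; _↔_; _↣_; _⇔_; Inverse; Injection; Equivalence; Injective; mk↣; mk⇔)
open import Function.Construct.Composition using (_↔-∘_; _↣-∘_; _⇔-∘_)
open import Function.Construct.Identity using (↔-id)
open import Function.Construct.Symmetry using (↔-sym; ⇔-sym)
open import Function.Properties.Inverse using (↔⇒↣)
open import Relation.Binary.Definitions using (tri<; tri≈; tri>)
open import Relation.Binary.PropositionalEquality hiding ([_])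
open import Relation.Nullary using (¬_; Dec; yes; no; does; ¬?; _×-dec_)
open import Relation.Nullary.Decidable using (dec-true; dec-false)

Fin-injective⇒surjective : ∀ {m} (f : Fin m → Fin m) → Injective _≡_ _≡_ f →
                           ∀ y → ∃ λ x → f x ≡ y
Fin-injective⇒surjective {suc m} f f-inj y with any? (λ x → f x ≟ y)
... | yes hit = hit
... | no miss = ⊥-elim (1+n≰n (injective⇒≤ f̂-injective))
  where
  f̂ : Fin (suc m) → Fin m
  f̂ x = punchOut (λ y≡fx → miss (x , sym y≡fx))

  f̂-injective : Injective _≡_ _≡_ f̂
  f̂-injective = f-inj ∘ punchOut-injective {i = y} _ _

module _ {A B : Set} {a b : ℕ} (enumA : Fin a ↔ A) (enumB : Fin b ↔ B)
         {f : A → B} (f-inj : Injective _≡_ _≡_ f) where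

  private
    f̂ : Fin a ↣ Fin b
    f̂ = ↔⇒↣ (↔-sym enumB) ↣-∘ (mk↣ f-inj ↣-∘ ↔⇒↣ enumA)

  injection⇒≤ : a ≤ b
  injection⇒≤ = injective⇒≤ (Injection.injective f̂)

  injection⇒surjective : a ≡ b → ∀ y → ∃ λ x → f x ≡ y
  injection⇒surjective refl y
    with x , f̂x≡y ← Fin-injective⇒surjective (Injection.to f̂) (Injection.injective f̂) (Inverse.from enumB y)
    = Inverse.to enumA x , Injection.injective (↔⇒↣ (↔-sym enumB)) f̂x≡y

covering⇒≤length : ∀ {n} (xs : List (Fin n)) → (∀ x → x ∈ xs) → n ≤ length xs
covering⇒≤length xs x∈xs = injective⇒≤ index-injective
  where
  index-injective : Injective _≡_ _≡_ (λ x → index (x∈xs x))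
  index-injective {x} {y} eq =
    trans (lookup-index (x∈xs x)) (trans (cong (lookup xs) eq) (sym (lookup-index (x∈xs y))))

minimal-witness : ∀ {P : ℕ → Set} → (∀ k → Dec (P k)) → ∃ P →
                  ∃ λ k → P k × (∀ i → i < k → ¬ P i)
minimal-witness P? (m , p) = search P? m p
  where
  search : ∀ {P : ℕ → Set} → (∀ k → Dec (P k)) → ∀ m → P m →
           ∃ λ k → P k × (∀ i → i < k → ¬ P i)
  search P? zero p = zero , p , λ _ ()
  search P? (suc m) p with P? zero
  ... | yes p₀ = zero , p₀ , λ _ ()
  ... | no ¬p₀ with k , pk , below ← search (P? ∘ suc) m p =
    suc k , pk , λ { zero _ → ¬p₀ ; (suc i) (s≤s i<k) → below i i<k }

+-tight : ∀ {a b c d} → a ≤ c → b ≤ d → a + b ≡ c + d → a ≡ c × b ≡ d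
+-tight {a} {b} {c} {d} a≤c b≤d sum≡ = a≡c , +-cancelˡ-≡ a b d (trans sum≡ (cong (_+ d) (sym a≡c)))
  where
  a≡c : a ≡ c
  a≡c = ≤-antisym a≤c (+-cancelʳ-≤ d c a (subst (_≤ a + d) sum≡ (+-monoʳ-≤ a b≤d)))

euler-tight : ∀ n f D → 2 * n + 2 * f ≡ D + 4 → f * 3 ≤ D → n * 6 ≤ D + 12 →
              f * 3 ≡ D × n * 6 ≡ D + 12
euler-tight n f D euler faces vertices =
  *-cancelˡ-≡ (f * 3) D 2 (proj₂ tight) , proj₁ tight
  where
  open +-*-Solver
  sum≡ : n * 6 + 2 * (f * 3) ≡ (D + 12) + 2 * D
  sum≡ = begin
    n * 6 + 2 * (f * 3)
      ≡⟨ solve 2 (λ n f → n :* con 6 :+ con 2 :* (f :* con 3) := con 3 :* (con 2 :* n :+ con 2 :* f)) refl n f ⟩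
    3 * (2 * n + 2 * f)
      ≡⟨ cong (3 *_) euler ⟩
    3 * (D + 4)
      ≡⟨ solve 1 (λ D → con 3 :* (D :+ con 4) := (D :+ con 12) :+ con 2 :* D) refl D ⟩
    (D + 12) + 2 * D
      ∎
    where open ≡-Reasoning

  tight : n * 6 ≡ D + 12 × 2 * (f * 3) ≡ 2 * D
  tight = +-tight vertices (*-monoʳ-≤ 2 faces) sum≡

≡ᵇ-∨-true⇔ : ∀ a b c d → ((a ≡ᵇ b) ∨ (c ≡ᵇ d)) ≡ true ⇔ (a ≡ b ⊎ c ≡ d)
≡ᵇ-∨-true⇔ a b c d = mk⇔
  (Sum.map (≡ᵇ⇒≡ a b) (≡ᵇ⇒≡ c d) ∘ Equivalence.to T-∨ ∘ Equivalence.from T-≡)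
  (Equivalence.to T-≡ ∘ Equivalence.from T-∨ ∘ Sum.map (≡⇒≡ᵇ a b) (≡⇒≡ᵇ c d))

module _ {n : ℕ} (G : Graph n) where
  open Graph G renaming (sym to E-sym)

  Adj-sym : ∀ {a b} → Adj G a b → Adj G b a
  Adj-sym {a} {b} ab = trans (E-sym b a) ab

  Adj-irrefl : ∀ {a b} → Adj G a b → a ≢ b
  Adj-irrefl {a} ab refl with () ← trans (sym ab) (irrefl a)

  MinDegree2 : Set
  MinDegree2 = ∀ y → ∃₂ λ a b → a ≢ b × Adj G y a × Adj G y b

  module _ {D : ℕ} (g : Fin D → Fin D) where

    iter-+ : ∀ a b d → iter G g (a + b) d ≡ iter G g a (iter G g b d)
    iter-+ zero    b d = refl
    iter-+ (suc a) b d = cong g (iter-+ a b d)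

    iter-fixpoint : ∀ {d} → g d ≡ d → ∀ k → iter G g k d ≡ d
    iter-fixpoint gd≡d zero    = refl
    iter-fixpoint gd≡d (suc k) = trans (cong g (iter-fixpoint gd≡d k)) gd≡d

    module _ (g-inj : Injective _≡_ _≡_ g) where

      iter-injective : ∀ k → Injective _≡_ _≡_ (iter G g k)
      iter-injective zero    = λ eq → eq
      iter-injective (suc k) = iter-injective k ∘ g-inj

      iter-cancel : ∀ i k {d} → iter G g (k + i) d ≡ iter G g i d → iter G g k d ≡ d
      iter-cancel i k {d} eq = iter-injective i (begin
        iter G g i (iter G g k d) ≡⟨ sym (iter-+ i k d) ⟩
        iter G g (i + k) d        ≡⟨ cong (λ j → iter G g j d) (+-comm i k) ⟩
        iter G g (k + i) d        ≡⟨ eq ⟩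
        iter G g i d              ∎)
        where open ≡-Reasoning

      repeat⇒return : ∀ {i j d} → i < j → iter G g j d ≡ iter G g i d →
                      ∃ λ k → suc k + i ≡ j × iter G g (suc k) d ≡ d
      repeat⇒return {i} {j} {d} i<j eq with k , i+k≡j ← m≤n⇒∃[o]m+o≡n i<j =
        k , k+i≡j , iter-cancel i (suc k) (trans (cong (λ m → iter G g m d) k+i≡j) eq)
        where
        k+i≡j : suc k + i ≡ j
        k+i≡j = trans (cong suc (+-comm k i)) i+k≡j

      module Period (x : Fin D) where

        private opaque
          returns : ∃ λ k → iter G g (suc k) x ≡ x
          returns
            with i , j , i<j , eq ← pigeonhole (n<1+n D) (λ (k : Fin (suc D)) → iter G g (toℕ k) x)
            with k , _ , gᵏ⁺¹x≡x ← repeat⇒return i<j (sym eq)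
            = k , gᵏ⁺¹x≡x

          shortest : ∃ λ k → iter G g (suc k) x ≡ x × (∀ i → i < k → iter G g (suc i) x ≢ x)
          shortest = minimal-witness (λ k → iter G g (suc k) x ≟ x) returns

        period : ℕ
        period = suc (proj₁ shortest)

        iter-period : iter G g period x ≡ x
        iter-period = proj₁ (proj₂ shortest)

        no-early-return : ∀ {i j} → i < j → j < period → iter G g j x ≢ iter G g i x
        no-early-return {i} i<j j<p eq with k , refl , returns ← repeat⇒return i<j eq =
          proj₂ (proj₂ shortest) k (m+n≤o⇒m≤o (suc k) (s<s⁻¹ j<p)) returns

        iter-injective-below-period : ∀ {i j} → i < period → j < period →
                                      iter G g i x ≡ iter G g j x → i ≡ j
        iter-injective-below-period {i} {j} i<p j<p eq with <-cmp i j
        ... | tri≈ _ i≡j _ = i≡j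
        ... | tri< i<j _ _ = ⊥-elim (no-early-return i<j j<p (sym eq))
        ... | tri> _ _ j<i = ⊥-elim (no-early-return j<i i<p eq)

        iter-below-period : ∀ k → ∃ λ i → i < period × iter G g i x ≡ iter G g k x
        iter-below-period zero = zero , z<s , refl
        iter-below-period (suc k) with i , i<p , eq ← iter-below-period k with m≤n⇒m<n∨m≡n i<p
        ... | inj₁ 1+i<p = suc i , 1+i<p , cong g eq
        ... | inj₂ 1+i≡p = zero , z<s , (begin
          x                     ≡⟨ sym iter-period ⟩
          iter G g period x     ≡⟨ cong (λ m → iter G g m x) (sym 1+i≡p) ⟩
          g (iter G g i x)      ≡⟨ cong g eq ⟩
          g (iter G g k x)      ∎)
          where open ≡-Reasoning

module RotationSystem {n : ℕ} {G : Graph n} (PE : PlanarEmbedding G) where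
  open PlanarEmbedding PE

  arc : ∀ a b → Adj G a b → Fin D
  arc a b ab = proj₁ (dartSurj a b ab)

  tail-arc : ∀ {a b} (ab : Adj G a b) → tail (arc a b ab) ≡ a
  tail-arc {a} {b} ab = proj₁ (proj₂ (dartSurj a b ab))

  head-arc : ∀ {a b} (ab : Adj G a b) → head (arc a b ab) ≡ b
  head-arc {a} {b} ab = proj₂ (proj₂ (dartSurj a b ab))

  θ-involutive : ∀ d → θ (θ d) ≡ d
  θ-involutive d = dartInj _ _ (trans (θ-tail (θ d)) (θ-head d)) (trans (θ-head (θ d)) (θ-tail d))

  θ-injective : Injective _≡_ _≡_ θ
  θ-injective {d} {d′} eq = trans (sym (θ-involutive d)) (trans (cong θ eq) (θ-involutive d′))

  σ-injective : Injective _≡_ _≡_ σ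
  σ-injective {d} {d′} eq = trans (sym (σ⁻¹σ d)) (trans (cong σ⁻¹ eq) (σ⁻¹σ d′))

  iter-σ-tail : ∀ k d → tail (iter G σ k d) ≡ tail d
  iter-σ-tail zero    d = refl
  iter-σ-tail (suc k) d = trans (σ-tail _) (iter-σ-tail k d)

  φ : Fin D → Fin D
  φ d = σ (θ d)

  φ-injective : Injective _≡_ _≡_ φ
  φ-injective = θ-injective ∘ σ-injective

  φ-tail : ∀ d → tail (φ d) ≡ head d
  φ-tail d = trans (σ-tail (θ d)) (θ-tail d)

  φ-fixpoint-free : ∀ d → φ d ≢ d
  φ-fixpoint-free d φd≡d = Adj-irrefl G (dartAdj d) (trans (sym (cong tail φd≡d)) (φ-tail d))

  φ²-fixpoint⇒degree1 : ∀ {d} → φ (φ d) ≡ d → ∀ d′ → tail d′ ≡ head d → d′ ≡ θ d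
  φ²-fixpoint⇒degree1 {d} φ²d≡d d′ tail≡
    with k , σᵏ≡d′ ← σ-cyc (θ d) d′ (trans (θ-tail d) (sym tail≡)) =
    trans (sym σᵏ≡d′) (iter-fixpoint G σ σθd≡θd k)
    where
    σθd≡θd : σ (θ d) ≡ θ d
    σθd≡θd = dartInj _ _ (trans (φ-tail d) (sym (θ-tail d)))
                         (trans (trans (sym (φ-tail (φ d))) (cong tail φ²d≡d)) (sym (θ-head d)))

  φ²-fixpoint-free : MinDegree2 G → ∀ d → φ (φ d) ≢ d
  φ²-fixpoint-free degree d φ²d≡d
    with a , b , a≢b , ya , yb ← degree (head d) =
    a≢b (begin
      a                    ≡⟨ sym (head-arc ya) ⟩
      head (arc _ a ya)    ≡⟨ cong head (φ²-fixpoint⇒degree1 φ²d≡d _ (tail-arc ya)) ⟩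
      head (θ d)           ≡⟨ cong head (sym (φ²-fixpoint⇒degree1 φ²d≡d _ (tail-arc yb))) ⟩
      head (arc _ b yb)    ≡⟨ head-arc yb ⟩
      b                    ∎)
    where open ≡-Reasoning

  φ^ : Fin 3 → Fin D → Fin D
  φ^ zero                d = d
  φ^ (suc zero)          d = φ d
  φ^ (suc (suc zero))    d = φ (φ d)

  face-φ^ : ∀ j d → face (φ^ j d) ≡ face d
  face-φ^ zero             d = refl
  face-φ^ (suc zero)       d = face-φ d
  face-φ^ (suc (suc zero)) d = trans (face-φ (φ d)) (face-φ d)

  face-start : Fin f → Fin D
  face-start i = proj₁ (face-surj i)

  face-steps : Fin f × Fin 3 → Fin D
  face-steps (i , j) = φ^ j (face-start i)

  face-face-steps : ∀ i j → face (face-steps (i , j)) ≡ i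
  face-face-steps i j = trans (face-φ^ j (face-start i)) (proj₂ (face-surj i))

  module _ (degree : MinDegree2 G) where

    private
      φ-no-1-cycle : ∀ {d} → d ≢ φ d
      φ-no-1-cycle eq = φ-fixpoint-free _ (sym eq)

      φ-no-2-cycle : ∀ {d} → d ≢ φ (φ d)
      φ-no-2-cycle eq = φ²-fixpoint-free degree _ (sym eq)

    φ^-injective : ∀ {j j′} d → φ^ j d ≡ φ^ j′ d → j ≡ j′
    φ^-injective {zero}             {zero}             d eq = refl
    φ^-injective {zero}             {suc zero}         d eq = ⊥-elim (φ-no-1-cycle eq)
    φ^-injective {zero}             {suc (suc zero)}   d eq = ⊥-elim (φ-no-2-cycle eq)
    φ^-injective {suc zero}         {zero}             d eq = ⊥-elim (φ-no-1-cycle (sym eq))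
    φ^-injective {suc zero}         {suc zero}         d eq = refl
    φ^-injective {suc zero}         {suc (suc zero)}   d eq = ⊥-elim (φ-no-1-cycle (φ-injective eq))
    φ^-injective {suc (suc zero)}   {zero}             d eq = ⊥-elim (φ-no-2-cycle (sym eq))
    φ^-injective {suc (suc zero)}   {suc zero}         d eq = ⊥-elim (φ-no-1-cycle (sym (φ-injective eq)))
    φ^-injective {suc (suc zero)}   {suc (suc zero)}   d eq = refl

    face-steps-injective : Injective _≡_ _≡_ face-steps
    face-steps-injective {i , j} {i′ , j′} eq
      with refl ← trans (sym (face-face-steps i j)) (trans (cong face eq) (face-face-steps i′ j′))
      = cong (i ,_) (φ^-injective (face-start i) eq)

    faces≤ : f * 3 ≤ D
    faces≤ = injection⇒≤ *↔× (↔-id _) face-steps-injective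

    face-steps-surjective : f * 3 ≡ D → ∀ d → ∃ λ ij → face-steps ij ≡ d
    face-steps-surjective = injection⇒surjective *↔× (↔-id _) face-steps-injective

    triangular : f * 3 ≡ D → ∀ d → φ (φ (φ d)) ≡ d
    triangular 3f≡D d with (i , j) , refl ← face-steps-surjective 3f≡D d =
      trans (φ³-φ^ j (face-start i)) (cong (φ^ j) (φ³-face-start i))
      where
      φ³-φ^ : ∀ j d → φ (φ (φ (φ^ j d))) ≡ φ^ j (φ (φ (φ d)))
      φ³-φ^ zero             d = refl
      φ³-φ^ (suc zero)       d = refl
      φ³-φ^ (suc (suc zero)) d = refl

      φ³-face-start : ∀ i → φ (φ (φ (face-start i))) ≡ face-start i
      φ³-face-start i
        with (i′ , j′) , eq ← face-steps-surjective 3f≡D (φ (φ (φ (face-start i))))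
        with refl ← trans (sym (face-face-steps i′ j′))
                          (trans (cong face eq) (trans (face-φ _) (face-face-steps i (suc (suc zero)))))
        with j′
      ... | zero             = sym eq
      ... | suc zero         = ⊥-elim (φ-no-2-cycle (φ-injective eq))
      ... | suc (suc zero)   = ⊥-elim (φ-no-1-cycle (φ-injective (φ-injective eq)))

  triangular⇒rotation-adjacent : (∀ d → φ (φ (φ d)) ≡ d) → ∀ e → Adj G (head (σ e)) (head e)
  triangular⇒rotation-adjacent φ³≡id e = subst₂ (Adj G) tail-d head-d (dartAdj d)
    where
    d : Fin D
    d = φ (φ (θ e))

    tail-d : tail d ≡ head (σ e)
    tail-d = trans (φ-tail (φ (θ e))) (cong (head ∘ σ) (θ-involutive e))

    head-d : head d ≡ head e
    head-d = trans (sym (φ-tail d)) (trans (cong tail (φ³≡id (θ e))) (θ-tail e))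

module TwoUniversalVertices {n : ℕ} {G : Graph n} (PE : PlanarEmbedding G) (tc : ThreeConnected G)
                 {u v : Fin n} (u≢v : u ≢ v) (u-universal : Ecc1 G u) (v-universal : Ecc1 G v) where
  open Graph G using (E; irrefl)
  open PlanarEmbedding PE
  open RotationSystem PE

  v≢u : v ≢ u
  v≢u = u≢v ∘ sym

  Inner : Fin n → Set
  Inner w = w ≢ u × w ≢ v

  inner? : ∀ w → Dec (Inner w)
  inner? w = ¬? (w ≟ u) ×-dec ¬? (w ≟ v)

  third-vertex : ∃ Inner
  third-vertex with any? inner?
  ... | yes found = found
  ... | no none = ⊥-elim (4≰2 (≤-trans (proj₁ tc) (covering⇒≤length (u ∷ v ∷ []) u-or-v)))
    where
    4≰2 : ¬ 4 ≤ 2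
    4≰2 (s≤s (s≤s ()))

    u-or-v : ∀ w → w ∈ u ∷ v ∷ []
    u-or-v w with w ≟ u | w ≟ v
    ... | yes w≡u | _       = here w≡u
    ... | no _    | yes w≡v = there (here w≡v)
    ... | no w≢u  | no w≢v  = ⊥-elim (none (w , w≢u , w≢v))

  min-degree-2 : MinDegree2 G
  min-degree-2 y with y ≟ u | y ≟ v | third-vertex
  ... | yes refl | _        | c , c≢u , c≢v = v , c , c≢v ∘ sym , u-universal v v≢u , u-universal c c≢u
  ... | no _     | yes refl | c , c≢u , c≢v = u , c , c≢u ∘ sym , v-universal u u≢v , v-universal c c≢v
  ... | no y≢u   | no y≢v   | _             =
    u , v , u≢v , Adj-sym G (u-universal y y≢u) , Adj-sym G (v-universal y y≢v)

  -- Each inner vertex other than the root picks an incident inner edge; next (next w) ≢ w makes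
  -- the picked edges distinct, as no edge is picked from both of its ends.
  record EdgeSelection : Set where
    field
      root       : Fin n
      next       : Fin n → Fin n
      next-inner : ∀ {w} → Inner w → w ≢ root → Inner (next w)
      next-adj   : ∀ {w} → Inner w → w ≢ root → Adj G w (next w)
      next-next  : ∀ {w} → Inner w → w ≢ root → next (next w) ≢ w

  orient : Fin 2 → Fin n × Fin n → Fin n × Fin n
  orient zero       (a , b) = a , b
  orient (suc zero) (a , b) = b , a

  module Counting (S : EdgeSelection) where
    open EdgeSelection S

    data Role (w : Fin n) : Set where
      is-u     : w ≡ u → Role w
      is-v     : w ≡ v → Role w
      is-root  : w ≡ root → Inner w → Role w
      is-inner : Inner w → w ≢ root → Role w

    role : ∀ w → Role w
    role w with w ≟ u | w ≟ v | w ≟ root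
    ... | yes w≡u | _       | _        = is-u w≡u
    ... | no w≢u  | yes w≡v | _        = is-v w≡v
    ... | no w≢u  | no w≢v  | yes w≡r  = is-root w≡r (w≢u , w≢v)
    ... | no w≢u  | no w≢v  | no w≢r   = is-inner (w≢u , w≢v) w≢r

    -- A slot (o , k) of an inner vertex w stands for the dart between w and u, v or next w
    -- (k = 0, 1, 2) leaving w (o = 0) or entering it (o = 1); u and v use only the slot (0 , 0),
    -- for the darts uv and vu. The remaining slots (five of u, five of v, the two next-slots of the
    -- root) go injectively to the 12 values of Extra, whence n * 6 ≤ D + 12.
    Slot : Set
    Slot = Fin 2 × Fin 3

    Extra : Set
    Extra = Fin 2 × Slot

    partner : Fin 3 → Fin n → Fin n
    partner zero             _ = u
    partner (suc zero)       _ = v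
    partner (suc (suc zero)) w = next w

    label : ∀ {w} → Role w → Slot → (Fin n × Fin n) ⊎ Extra
    label (is-u _)      (zero , zero)       = inj₁ (u , v)
    label (is-u _)      s                   = inj₂ (zero , s)
    label (is-v _)      (zero , zero)       = inj₁ (v , u)
    label (is-v _)      s                   = inj₂ (suc zero , s)
    label (is-root _ _) (o , suc (suc zero)) = inj₂ (o , zero , zero)
    label {w} _         (o , k)             = inj₁ (orient o (w , partner k w))

    _==_ : Fin n → Fin n → Bool
    a == b = does (a ≟ b)

    decode-pair : Fin n → Fin n → Fin n × Slot
    decode-pair a b =
      if a == u then (if b == v then (u , zero , zero) else (b , suc zero , zero))
      else if b == u then (a , zero , zero)
      else if a == v then (b , suc zero , suc zero)
      else if b == v then (a , zero , suc zero)
      else if next a == b then (a , zero , suc (suc zero))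
      else (b , suc zero , suc (suc zero))

    decode : (Fin n × Fin n) ⊎ Extra → Fin n × Slot
    decode (inj₁ (a , b))          = decode-pair a b
    decode (inj₂ (o , zero , zero)) = root , o , suc (suc zero)
    decode (inj₂ (zero , s))       = u , s
    decode (inj₂ (suc zero , s))   = v , s

    decode-u : ∀ {w} → Inner w → ∀ o → decode (inj₁ (orient o (w , u))) ≡ (w , o , zero)
    decode-u {w} (w≢u , w≢v) zero
      rewrite dec-false (w ≟ u) w≢u | dec-true (u ≟ u) refl = refl
    decode-u {w} (w≢u , w≢v) (suc zero)
      rewrite dec-true (u ≟ u) refl | dec-false (w ≟ v) w≢v = refl

    decode-v : ∀ {w} → Inner w → ∀ o → decode (inj₁ (orient o (w , v))) ≡ (w , o , suc zero)
    decode-v {w} (w≢u , w≢v) zero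
      rewrite dec-false (w ≟ u) w≢u | dec-false (v ≟ u) v≢u | dec-false (w ≟ v) w≢v
            | dec-true (v ≟ v) refl = refl
    decode-v {w} (w≢u , w≢v) (suc zero)
      rewrite dec-false (v ≟ u) v≢u | dec-false (w ≟ u) w≢u | dec-true (v ≟ v) refl = refl

    decode-next : ∀ {w} → Inner w → w ≢ root → ∀ o →
                  decode (inj₁ (orient o (w , next w))) ≡ (w , o , suc (suc zero))
    decode-next {w} (w≢u , w≢v) w≢r zero
      with x≢u , x≢v ← next-inner (w≢u , w≢v) w≢r
      rewrite dec-false (w ≟ u) w≢u | dec-false (next w ≟ u) x≢u | dec-false (w ≟ v) w≢v
            | dec-false (next w ≟ v) x≢v | dec-true (next w ≟ next w) refl = refl
    decode-next {w} (w≢u , w≢v) w≢r (suc zero)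
      with x≢u , x≢v ← next-inner (w≢u , w≢v) w≢r
      rewrite dec-false (next w ≟ u) x≢u | dec-false (w ≟ u) w≢u | dec-false (next w ≟ v) x≢v
            | dec-false (w ≟ v) w≢v | dec-false (next (next w) ≟ w) (next-next (w≢u , w≢v) w≢r) = refl

    decode-label : ∀ {w} (ρ : Role w) s → decode (label ρ s) ≡ (w , s)
    decode-label (is-u refl) (zero , zero)
      rewrite dec-true (u ≟ u) refl | dec-true (v ≟ v) refl = refl
    decode-label (is-u refl) (zero , suc k)    = refl
    decode-label (is-u refl) (suc zero , k)    = refl
    decode-label (is-v refl) (zero , zero)
      rewrite dec-false (v ≟ u) v≢u | dec-true (u ≟ u) refl = refl
    decode-label (is-v refl) (zero , suc k)    = refl
    decode-label (is-v refl) (suc zero , k)    = refl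
    decode-label (is-root refl wi) (o , zero)             = decode-u wi o
    decode-label (is-root refl wi) (o , suc zero)         = decode-v wi o
    decode-label (is-root refl wi) (o , suc (suc zero))   = refl
    decode-label (is-inner wi w≢r) (o , zero)             = decode-u wi o
    decode-label (is-inner wi w≢r) (o , suc zero)         = decode-v wi o
    decode-label (is-inner wi w≢r) (o , suc (suc zero))   = decode-next wi w≢r o

    Valid : (Fin n × Fin n) ⊎ Extra → Set
    Valid (inj₁ (a , b)) = Adj G a b
    Valid (inj₂ _)       = ⊤

    orient-valid : ∀ {a b} → Adj G a b → ∀ o → Valid (inj₁ (orient o (a , b)))
    orient-valid ab zero       = ab
    orient-valid ab (suc zero) = Adj-sym G ab

    label-valid : ∀ {w} (ρ : Role w) s → Valid (label ρ s)
    label-valid (is-u refl) (zero , zero)    = u-universal v v≢u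
    label-valid (is-u refl) (zero , suc k)   = tt
    label-valid (is-u refl) (suc zero , k)   = tt
    label-valid (is-v refl) (zero , zero)    = v-universal u u≢v
    label-valid (is-v refl) (zero , suc k)   = tt
    label-valid (is-v refl) (suc zero , k)   = tt
    label-valid (is-root refl (w≢u , w≢v)) (o , zero)           = orient-valid (Adj-sym G (u-universal _ w≢u)) o
    label-valid (is-root refl (w≢u , w≢v)) (o , suc zero)       = orient-valid (Adj-sym G (v-universal _ w≢v)) o
    label-valid (is-root refl (w≢u , w≢v)) (o , suc (suc zero)) = tt
    label-valid (is-inner (w≢u , w≢v) w≢r) (o , zero)           = orient-valid (Adj-sym G (u-universal _ w≢u)) o
    label-valid (is-inner (w≢u , w≢v) w≢r) (o , suc zero)       = orient-valid (Adj-sym G (v-universal _ w≢v)) o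
    label-valid (is-inner wi w≢r)          (o , suc (suc zero)) = orient-valid (next-adj wi w≢r) o

    realise : (x : (Fin n × Fin n) ⊎ Extra) → Valid x → Fin D ⊎ Extra
    realise (inj₁ (a , b)) ab = inj₁ (arc a b ab)
    realise (inj₂ e)       _  = inj₂ e

    ends : Fin D ⊎ Extra → (Fin n × Fin n) ⊎ Extra
    ends = map₁ (λ d → tail d , head d)

    ends-realise : ∀ x (vx : Valid x) → ends (realise x vx) ≡ x
    ends-realise (inj₁ (a , b)) ab = cong inj₁ (cong₂ _,_ (tail-arc ab) (head-arc ab))
    ends-realise (inj₂ e)       _  = refl

    slot : Fin n × Slot → Fin D ⊎ Extra
    slot (w , s) = realise (label (role w) s) (label-valid (role w) s)

    ends-slot : ∀ w s → ends (slot (w , s)) ≡ label (role w) s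
    ends-slot w s = ends-realise (label (role w) s) (label-valid (role w) s)

    slot-injective : Injective _≡_ _≡_ slot
    slot-injective {w , s} {w′ , s′} eq = begin
      (w , s)                       ≡⟨ sym (decode-label (role w) s) ⟩
      decode (label (role w) s)     ≡⟨ cong decode (sym (ends-slot w s)) ⟩
      decode (ends (slot (w , s)))  ≡⟨ cong (decode ∘ ends) eq ⟩
      decode (ends (slot (w′ , s′))) ≡⟨ cong decode (ends-slot w′ s′) ⟩
      decode (label (role w′) s′)   ≡⟨ decode-label (role w′) s′ ⟩
      (w′ , s′)                     ∎
      where open ≡-Reasoning

    slots↔ : Fin (n * 6) ↔ (Fin n × Slot)
    slots↔ = (↔-id _ ×-↔ *↔×) ↔-∘ *↔×

    targets↔ : Fin (D + 12) ↔ (Fin D ⊎ Extra)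
    targets↔ = (↔-id _ ⊎-↔ ((↔-id _ ×-↔ *↔×) ↔-∘ *↔×)) ↔-∘ +↔⊎

    vertices≤ : n * 6 ≤ D + 12
    vertices≤ = injection⇒≤ slots↔ targets↔ slot-injective

    Selected : Fin n → Fin n → Set
    Selected a b = ∃ λ w → Inner w × w ≢ root × ∃ λ o → orient o (w , next w) ≡ (a , b)

    orient-meets : ∀ o {w x a b} → orient o (w , x) ≡ (a , b) → a ≡ x ⊎ b ≡ x
    orient-meets zero       refl = inj₂ refl
    orient-meets (suc zero) refl = inj₁ refl

    label-inner-selected : ∀ {w a b} (ρ : Role w) s → label ρ s ≡ inj₁ (a , b) →
                           Inner a → Inner b → Selected a b
    label-inner-selected (is-u refl) (zero , zero) refl (a≢u , _) _ = ⊥-elim (a≢u refl)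
    label-inner-selected (is-u refl) (zero , suc k) ()
    label-inner-selected (is-u refl) (suc zero , k) ()
    label-inner-selected (is-v refl) (zero , zero) refl _ (b≢u , _) = ⊥-elim (b≢u refl)
    label-inner-selected (is-v refl) (zero , suc k) ()
    label-inner-selected (is-v refl) (suc zero , k) ()
    label-inner-selected (is-root refl _) (o , zero) eq (a≢u , _) (b≢u , _) =
      ⊥-elim ([ a≢u , b≢u ] (orient-meets o (inj₁-injective eq)))
    label-inner-selected (is-root refl _) (o , suc zero) eq (_ , a≢v) (_ , b≢v) =
      ⊥-elim ([ a≢v , b≢v ] (orient-meets o (inj₁-injective eq)))
    label-inner-selected (is-root refl _) (o , suc (suc zero)) ()
    label-inner-selected (is-inner _ _) (o , zero) eq (a≢u , _) (b≢u , _) =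
      ⊥-elim ([ a≢u , b≢u ] (orient-meets o (inj₁-injective eq)))
    label-inner-selected (is-inner _ _) (o , suc zero) eq (_ , a≢v) (_ , b≢v) =
      ⊥-elim ([ a≢v , b≢v ] (orient-meets o (inj₁-injective eq)))
    label-inner-selected {w} (is-inner wi w≢r) (o , suc (suc zero)) eq _ _ =
      w , wi , w≢r , o , inj₁-injective eq

    tight⇒inner-darts-selected : n * 6 ≡ D + 12 →
                                 ∀ d → Inner (tail d) → Inner (head d) → Selected (tail d) (head d)
    tight⇒inner-darts-selected tight d
      with (w , s) , eq ← injection⇒surjective slots↔ targets↔ slot-injective tight (inj₁ d)
      = label-inner-selected (role w) s (trans (sym (ends-slot w s)) (cong ends eq))

  inner⇒∉ : ∀ {w} → Inner w → w ∉ u ∷ v ∷ []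
  inner⇒∉ (w≢u , _)   (here w≡u)         = w≢u w≡u
  inner⇒∉ (_   , w≢v) (there (here w≡v)) = w≢v w≡v

  module BreadthFirst (r : Fin n) (r-inner : Inner r) where

    Walk : ℕ → Fin n → Set
    Walk zero    w = w ≡ r
    Walk (suc j) w = ∃ λ x → Adj G w x × Inner x × Walk j x

    walk? : ∀ j w → Dec (Walk j w)
    walk? zero    w = w ≟ r
    walk? (suc j) w = any? (λ x → (E w x Bool.≟ true) ×-dec (inner? x ×-dec walk? j x))

    length-of : ∀ {w} → WalkIn G (_∉ u ∷ v ∷ []) w r → ∃ λ j → Walk j w
    length-of here = zero , refl
    length-of (step wx x∉ walk) with j , W ← length-of walk =
      suc j , _ , wx , (x∉ ∘ here , x∉ ∘ there ∘ here) , W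

    shortest : ∀ {w} → Inner w → ∃ λ j → Walk j w × (∀ i → i < j → ¬ Walk i w)
    shortest wi = minimal-witness (λ j → walk? j _)
      (length-of (proj₂ tc (u ∷ v ∷ []) (s≤s (s≤s z≤n)) _ r (inner⇒∉ wi) (inner⇒∉ r-inner)))

    depth : ∀ w → Inner w → ℕ
    depth w wi = proj₁ (shortest wi)

    depth-minimal : ∀ {w} (wi : Inner w) j → Walk j w → depth w wi ≤ j
    depth-minimal wi j W = ≮⇒≥ (λ j<depth → proj₂ (proj₂ (shortest wi)) j j<depth W)

    closer : ∀ {w} (wi : Inner w) → w ≢ r →
             ∃ λ x → Adj G w x × Σ (Inner x) λ xi → depth x xi < depth w wi
    closer wi w≢r with shortest wi
    ... | zero  , w≡r , _              = ⊥-elim (w≢r w≡r)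
    ... | suc j , (x , wx , xi , W) , _ = x , wx , xi , s≤s (depth-minimal xi j W)

    next : Fin n → Fin n
    next w with inner? w | w ≟ r
    ... | yes wi | no w≢r = proj₁ (closer wi w≢r)
    ... | _      | _      = r

    next-closer : ∀ {w} (wi : Inner w) (w≢r : w ≢ r) → next w ≡ proj₁ (closer wi w≢r)
    next-closer {w} wi w≢r with inner? w | w ≟ r
    ... | yes _   | no _    = refl  -- proofs of a negation are definitionally equal
    ... | no ¬wi  | _       = ⊥-elim (¬wi wi)
    ... | yes _   | yes w≡r = ⊥-elim (w≢r w≡r)

    next-root : next r ≡ r
    next-root with inner? r | r ≟ r
    ... | yes _ | no r≢r = ⊥-elim (r≢r refl)
    ... | yes _ | yes _  = refl
    ... | no _  | _      = refl

    next-inner : ∀ {w} → Inner w → w ≢ r → Inner (next w)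
    next-inner wi w≢r = subst Inner (sym (next-closer wi w≢r)) (proj₁ (proj₂ (proj₂ (closer wi w≢r))))

    next-deeper : ∀ {w} (wi : Inner w) → w ≢ r → ∀ (xi : Inner (next w)) → depth (next w) xi < depth w wi
    next-deeper {w} wi w≢r =
      subst (λ x → ∀ (xi : Inner x) → depth x xi < depth w wi) (sym (next-closer wi w≢r))
            (λ _ → proj₂ (proj₂ (proj₂ (closer wi w≢r))))

    next-next : ∀ {w} → Inner w → w ≢ r → next (next w) ≢ w
    next-next {w} wi w≢r loop = from-next (next w ≟ r)
      where
      from-next : Dec (next w ≡ r) → ⊥
      from-next (yes x≡r) = w≢r (trans (sym loop) (trans (cong next x≡r) next-root))
      from-next (no x≢r)  = <-asym (next-deeper wi w≢r xi) back
        where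
        xi = next-inner wi w≢r
        back : depth w wi < depth (next w) xi
        back = subst (λ y → ∀ (yi : Inner y) → depth y yi < depth (next w) xi) loop (next-deeper xi x≢r) wi

    selection : EdgeSelection
    selection = record
      { root       = r
      ; next       = next
      ; next-inner = next-inner
      ; next-adj   = λ wi w≢r → subst (Adj G _) (sym (next-closer wi w≢r)) (proj₁ (proj₂ (closer wi w≢r)))
      ; next-next  = next-next
      }

  counts-tight : f * 3 ≡ D × n * 6 ≡ D + 12
  counts-tight = euler-tight n f D euler (faces≤ min-degree-2) (Counting.vertices≤ bfs)
    where bfs = BreadthFirst.selection (proj₁ third-vertex) (proj₂ third-vertex)

  rotation-adjacent : ∀ e → Adj G (head (σ e)) (head e)
  rotation-adjacent = triangular⇒rotation-adjacent (triangular min-degree-2 (proj₁ counts-tight))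

  e₀ : Fin D
  e₀ = arc u v (u-universal v v≢u)

  open Period G σ σ-injective e₀

  -- period is a successor by definition, so suc ℓ reduces to period.
  ℓ : ℕ
  ℓ = pred period

  neighbour : ℕ → Fin n
  neighbour k = head (iter G σ k e₀)

  tail-iter : ∀ k → tail (iter G σ k e₀) ≡ u
  tail-iter k = trans (iter-σ-tail k e₀) (tail-arc _)

  u-neighbour : ∀ k → Adj G u (neighbour k)
  u-neighbour k = subst (λ x → Adj G x (neighbour k)) (tail-iter k) (dartAdj _)

  neighbour≢u : ∀ k → neighbour k ≢ u
  neighbour≢u k = Adj-irrefl G (u-neighbour k) ∘ sym

  neighbour-zero : neighbour 0 ≡ v
  neighbour-zero = head-arc _

  neighbour-period : neighbour period ≡ v
  neighbour-period = trans (cong head iter-period) neighbour-zero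

  neighbour-injective : ∀ {i j} → i < period → j < period → neighbour i ≡ neighbour j → i ≡ j
  neighbour-injective {i} {j} i<p j<p eq =
    iter-injective-below-period i<p j<p (dartInj _ _ (trans (tail-iter i) (sym (tail-iter j))) eq)

  neighbour-consecutive : ∀ k → Adj G (neighbour k) (neighbour (suc k))
  neighbour-consecutive k = Adj-sym G (rotation-adjacent (iter G σ k e₀))

  neighbour-inner : ∀ {k} → suc k < period → Inner (neighbour (suc k))
  neighbour-inner {k} 1+k<p =
    neighbour≢u (suc k) , λ eq → 1+n≢0 (neighbour-injective 1+k<p z<s (trans eq (sym neighbour-zero)))

  position-spec : ∀ w → ∃ λ k → k < period × (w ≢ u → neighbour k ≡ w)
  position-spec w with w ≟ u
  ... | yes w≡u = 0 , z<s , λ w≢u → ⊥-elim (w≢u w≡u)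
  ... | no w≢u
    with j , σʲ≡d ← σ-cyc e₀ (arc u w (u-universal w w≢u)) (trans (tail-arc _) (sym (tail-arc _)))
    with k , k<p , σᵏ≡σʲ ← iter-below-period j
    = k , k<p , λ _ → trans (cong head (trans σᵏ≡σʲ σʲ≡d)) (head-arc _)

  position : Fin n → ℕ
  position w = proj₁ (position-spec w)

  position<period : ∀ w → position w < period
  position<period w = proj₁ (proj₂ (position-spec w))

  neighbour-position : ∀ {w} → w ≢ u → neighbour (position w) ≡ w
  neighbour-position {w} = proj₂ (proj₂ (position-spec w))

  position-neighbour : ∀ {k} → k < period → position (neighbour k) ≡ k
  position-neighbour {k} k<p =
    neighbour-injective (position<period (neighbour k)) k<p (neighbour-position (neighbour≢u k))

  position<ℓ : ∀ {w} → w ≢ u → w ≢ neighbour ℓ → position w < ℓ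
  position<ℓ {w} w≢u w≢last = ≤∧≢⇒< (s≤s⁻¹ (position<period w))
    (λ eq → w≢last (trans (sym (neighbour-position w≢u)) (cong neighbour eq)))

  position-next : ∀ {w} → w ≢ u → w ≢ neighbour ℓ →
                  position (neighbour (suc (position w))) ≡ suc (position w)
  position-next w≢u w≢last = position-neighbour (s≤s (position<ℓ w≢u w≢last))

  path : EdgeSelection
  path = record
    { root       = neighbour ℓ
    ; next       = λ w → neighbour (suc (position w))
    ; next-inner = λ (w≢u , _) w≢last → neighbour-inner (s≤s (position<ℓ w≢u w≢last))
    ; next-adj   = λ {w} (w≢u , _) _ →
        subst (λ x → Adj G x (neighbour (suc (position w)))) (neighbour-position w≢u)
              (neighbour-consecutive (position w))
    ; next-next  = next-next
    }
    where
    next-next : ∀ {w} → Inner w → w ≢ neighbour ℓ →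
                neighbour (suc (position (neighbour (suc (position w))))) ≢ w
    next-next {w} (w≢u , w≢v) w≢last loop = two-steps (m≤n⇒m<n∨m≡n (s≤s (position<ℓ w≢u w≢last)))
      where
      p = position w

      two-steps-back : neighbour (suc (suc p)) ≡ w
      two-steps-back = trans (cong (neighbour ∘ suc) (sym (position-next w≢u w≢last))) loop

      two-steps : suc (suc p) < period ⊎ suc (suc p) ≡ period → ⊥
      two-steps (inj₁ 2+p<period) = m≢1+n+m p (sym (neighbour-injective 2+p<period (position<period w)
                                      (trans two-steps-back (sym (neighbour-position w≢u)))))
      two-steps (inj₂ 2+p≡period) =
        w≢v (trans (sym two-steps-back) (trans (cong neighbour 2+p≡period) neighbour-period))

  path-step : ∀ o {w a b} → w ≢ u → w ≢ neighbour ℓ →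
              orient o (w , neighbour (suc (position w))) ≡ (a , b) →
              position b ≡ suc (position a) ⊎ position a ≡ suc (position b)
  path-step zero       w≢u w≢last refl = inj₁ (position-next w≢u w≢last)
  path-step (suc zero) w≢u w≢last refl = inj₂ (position-next w≢u w≢last)

  path-edge : ∀ {a b} → Inner a → Inner b → Adj G a b →
              position b ≡ suc (position a) ⊎ position a ≡ suc (position b)
  path-edge {a} {b} ai bi ab =
    from-selected (Counting.tight⇒inner-darts-selected path (proj₂ counts-tight) (arc a b ab)
                    (subst Inner (sym (tail-arc ab)) ai) (subst Inner (sym (head-arc ab)) bi))
    where
    from-selected : Counting.Selected path (tail (arc a b ab)) (head (arc a b ab)) →
                    position b ≡ suc (position a) ⊎ position a ≡ suc (position b)
    from-selected (w , (w≢u , _) , w≢last , o , eq) =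
      path-step o w≢u w≢last (trans eq (cong₂ _,_ (tail-arc ab) (head-arc ab)))

  vertex : Fin (2 + ℓ) → Fin n
  vertex zero    = u
  vertex (suc i) = neighbour (toℕ i)

  vertex-injective : Injective _≡_ _≡_ vertex
  vertex-injective {zero}  {zero}  _  = refl
  vertex-injective {zero}  {suc j} eq = ⊥-elim (neighbour≢u (toℕ j) (sym eq))
  vertex-injective {suc i} {zero}  eq = ⊥-elim (neighbour≢u (toℕ i) eq)
  vertex-injective {suc i} {suc j} eq = cong suc (toℕ-injective (neighbour-injective (toℕ<n i) (toℕ<n j) eq))

  vertex-surjective : ∀ w → ∃ λ x → vertex x ≡ w
  vertex-surjective w with w ≟ u
  ... | yes w≡u = zero , sym w≡u
  ... | no w≢u  = suc (fromℕ< (position<period w)) ,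
                  trans (cong neighbour (toℕ-fromℕ< (position<period w))) (neighbour-position w≢u)

  path-adjacent⇔ : ∀ {i j} → suc i < period → suc j < period →
                   Adj G (neighbour (suc i)) (neighbour (suc j)) ⇔ (suc i ≡ j ⊎ suc j ≡ i)
  path-adjacent⇔ {i} {j} 1+i<p 1+j<p = mk⇔ to from
    where
    to : Adj G (neighbour (suc i)) (neighbour (suc j)) → suc i ≡ j ⊎ suc j ≡ i
    to ab = Sum.map (sym ∘ suc-injective) (sym ∘ suc-injective)
      (subst₂ (λ p q → q ≡ suc p ⊎ p ≡ suc q) (position-neighbour 1+i<p) (position-neighbour 1+j<p)
              (path-edge (neighbour-inner 1+i<p) (neighbour-inner 1+j<p) ab))

    from : suc i ≡ j ⊎ suc j ≡ i → Adj G (neighbour (suc i)) (neighbour (suc j))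
    from (inj₁ refl) = neighbour-consecutive (suc i)
    from (inj₂ refl) = Adj-sym G (neighbour-consecutive (suc j))

  E-vertex : ∀ x y → E (vertex x) (vertex y) ≡ TE ℓ x y
  E-vertex zero          zero          = irrefl u
  E-vertex zero          (suc j)       = u-neighbour (toℕ j)
  E-vertex (suc zero)    zero          = Adj-sym G (u-neighbour 0)
  E-vertex (suc (suc i)) zero          = Adj-sym G (u-neighbour (toℕ (suc i)))
  E-vertex (suc zero)    (suc zero)    = irrefl (neighbour 0)
  E-vertex (suc zero)    (suc (suc j)) =
    subst (λ x → Adj G x (vertex (suc (suc j)))) (sym neighbour-zero)
          (v-universal _ (proj₂ (neighbour-inner (toℕ<n (suc j)))))
  E-vertex (suc (suc i)) (suc zero)    = Adj-sym G (E-vertex (suc zero) (suc (suc i)))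
  E-vertex (suc (suc i)) (suc (suc j)) =
    ⇔→≡ (⇔-sym (≡ᵇ-∨-true⇔ _ _ _ _) ⇔-∘ path-adjacent⇔ (toℕ<n (suc i)) (toℕ<n (suc j)))

  iso : IsoToT G ℓ
  iso = record
    { to        = to
    ; from      = vertex
    ; from-to   = from-to
    ; to-from   = λ x → vertex-injective (from-to (vertex x))
    ; preserves = λ a b → subst₂ (λ a′ b′ → E a′ b′ ≡ TE ℓ (to a) (to b)) (from-to a) (from-to b)
                                 (E-vertex (to a) (to b))
    }
    where
    to : Fin n → Fin (2 + ℓ)
    to w = proj₁ (vertex-surjective w)

    from-to : ∀ w → vertex (to w) ≡ w
    from-to w = proj₂ (vertex-surjective w)

  2≤ℓ : 2 ≤ ℓ
  2≤ℓ = s≤s⁻¹ (s≤s⁻¹ (≤-trans (proj₁ tc) (injective⇒≤ to-injective)))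
    where
    open IsoToT iso
    to-injective : Injective _≡_ _≡_ to
    to-injective {a} {b} eq = trans (sym (from-to a)) (trans (cong from eq) (from-to b))

  isomorphic-to-T : ∃ λ ℓ → 2 ≤ ℓ × IsoToT G ℓ
  isomorphic-to-T = ℓ , 2≤ℓ , iso

lemma4p1 : ∀ {n} (G : Graph n) → Polyhedron G → Radius1 G →
    (∀ ℓ → 2 ≤ ℓ → ¬ IsoToT G ℓ) →
    ∃ λ v → Ecc1 G v × (∀ w → Ecc1 G w → w ≡ v)
lemma4p1 G (PE , tc) (v , v-universal) not-T = v , v-universal , unique
  where
  unique : ∀ w → Ecc1 G w → w ≡ v
  unique w w-universal with w ≟ v
  ... | yes w≡v = w≡v
  ... | no w≢v with ℓ , 2≤ℓ , T ← TwoUniversalVertices.isomorphic-to-T PE tc w≢v w-universal v-universal =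
    ⊥-elim (not-T ℓ 2≤ℓ T)
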